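{- For every positive integer $n$ and all integers $m$, $p$, $q$: \[ \sum_{j = 0}^n \sum_{k = 0}^j \binom{n}{j}\binom{j}{k}P_{p - 4}^k P_{p - 3}^{j - k} P_{p - 5}^{n - j} P_{mn + q + k + j} = P_{(m + p)n + q}, \] \[ \sum_{j = 0}^n \sum_{k = 0}^j \binom{n}{j}\binom{j}{k}P_{m - 4}^k P_{m - 3}^{j - k} P_{m - 5}^{n - j} P_{pn + q + k + j} = P_{(m + p)n + q}, \] \[ \sum_{j = 0}^n \sum_{k = 0}^j \binom{n}{j}\binom{j}{k}P_{p - 4}^k P_{p - 3}^{j - k} P_{p - 5}^{n - j} Q_{mn + q + k + j} = Q_{(m + p)n + q}, \] \[ \sum_{j = 0}^n \sum_{k = 0}^j \binom{n}{j}\binom{j}{k}P_{m - 4}^k P_{m - 3}^{j - k} P_{m - 5}^{n - j} Q_{pn + q + k + j} = Q_{(m + p)n + q}. \]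
   Context: The Padovan numbers $P_n$ are defined for all integers $n$ by $P_0=P_1=P_2=1$ and $P_n=P_{n-2}+P_{n-3}$ for all integers $n$ (extended to negative indices via $P_n=P_{n+3}-P_{n+1}$). The Perrin numbers $Q_n$ are defined for all integers $n$ by $Q_0=3$, $Q_1=0$, $Q_2=2$ and $Q_n=Q_{n-2}+Q_{n-3}$ for all integers $n$. -}

module Defs where

open import Data.Nat as ℕ using (ℕ; zero; suc)
open import Data.Integer using (ℤ; +_; -[1+_]; _+_; _-_; _*_; _^_)
open import Data.Nat.Combinatorics using (_C_)
open import Data.Product using (_×_; _,_; proj₁)

-- A third-order window (a_n, a_{n+1}, a_{n+2}) of a sequence satisfying
-- a_{n+3} = a_{n+1} + a_n, stepped forward and backward.
Window : Set
Window = ℤ × ℤ × ℤ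

stepF : Window → Window
stepF (a , b , c) = (b , c , b + a)

-- (a_n, a_{n+1}, a_{n+2}) ↦ (a_{n-1}, a_n, a_{n+1}) with a_{n-1} = a_{n+2} - a_n
stepB : Window → Window
stepB (a , b , c) = (c - a , a , b)

iterF : ℕ → Window → Window
iterF zero w = w
iterF (suc k) w = iterF k (stepF w)

iterB : ℕ → Window → Window
iterB zero w = w
iterB (suc k) w = iterB k (stepB w)

-- a_n for an integer index n, given the window (a_0, a_1, a_2)
seqAt : Window → ℤ → ℤ
seqAt w (+ n) = proj₁ (iterF n w)
seqAt w -[1+ n ] = proj₁ (iterB (suc n) w)

-- Padovan numbers: P_0 = P_1 = P_2 = 1, P_n = P_{n-2} + P_{n-3} for all n ∈ ℤ
P : ℤ → ℤ
P = seqAt (+ 1 , + 1 , + 1)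

-- Perrin numbers: Q_0 = 3, Q_1 = 0, Q_2 = 2, Q_n = Q_{n-2} + Q_{n-3} for all n ∈ ℤ
Q : ℤ → ℤ
Q = seqAt (+ 3 , + 0 , + 2)

sumTo : ℕ → (ℕ → ℤ) → ℤ
sumTo zero f = f zero
sumTo (suc n) f = sumTo n f + f (suc n)

doubleSum : ℕ → ℤ → ℤ → ℤ → (ℤ → ℤ) → ℤ → ℤ
doubleSum n a b c F s =
  sumTo n λ j → sumTo j λ k →
    (+ (n C j)) * (+ (j C k)) * (a ^ k) * (b ^ (j ℕ.∸ k)) * (c ^ (n ℕ.∸ j))
      * F (s + + k + + j)

module Submission where

open import Defs
open import Data.Nat using (ℕ; NonZero)
open import Data.Integer using (ℤ; +_; _+_; _-_; _*_)
open import Data.Product using (_×_)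
open import Relation.Binary.PropositionalEquality using (_≡_)

open import Data.Nat using (zero; suc; _≤_; _∸_; z≤n)
import Data.Nat as ℕ
import Data.Nat.Properties as ℕₚ
open import Data.Nat.GeneralisedArithmetic using (iterate)
open import Data.Nat.Combinatorics using (_C_; nCk+nC[k+1]≡[n+1]C[k+1])
open import Data.Nat.Combinatorics.Specification using (k>n⇒nCk≡0)
open import Data.Integer using (-[1+_]; -_; _^_)
import Data.Integer.Properties as ℤₚ
open import Data.Integer.Tactic.RingSolver using (solve-∀)
open import Data.Product using (_,_; proj₁)
open import Function using (_∘_)
open import Relation.Binary.PropositionalEquality
  using (_≗_; refl; sym; trans; cong; cong₂; subst; module ≡-Reasoning)

-- Write α = P_{p-5}, β = P_{p-3}, γ = P_{p-4}.  The heart of the proof is the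
-- addition formula  F_{u+p} = α F_u + β F_{u+1} + γ F_{u+2},  valid for every
-- sequence F satisfying F_{t+3} = F_{t+1} + F_t (in particular F = P and
-- F = Q): both sides satisfy the recurrence in p and agree for p = 0, 1, 2.
-- In terms of the shift operator E (E G)(u) = G(u+1) this says that the
-- operator L = α + (γE + β)E acts on such F as the shift by p, hence L^n acts
-- as the shift by pn.  Expanding L^n by the binomial theorem for a linear
-- operator (twice: once for L = (γE+β)E + α, once for γE + β) and using that
-- E commutes with γE + β produces exactly the double sum of the theorem.

sumTo-cong : ∀ n {f g : ℕ → ℤ} → (∀ k → k ≤ n → f k ≡ g k) → sumTo n f ≡ sumTo n g
sumTo-cong zero    eq = eq 0 z≤n
sumTo-cong (suc n) eq =
  cong₂ _+_ (sumTo-cong n (λ k k≤n → eq k (ℕₚ.m≤n⇒m≤1+n k≤n))) (eq (suc n) ℕₚ.≤-refl)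

sumTo-+ : ∀ n (f g : ℕ → ℤ) → sumTo n (λ k → f k + g k) ≡ sumTo n f + sumTo n g
sumTo-+ zero    f g = refl
sumTo-+ (suc n) f g =
  trans (cong (_+ (f (suc n) + g (suc n))) (sumTo-+ n f g))
        (interchange (sumTo n f) (sumTo n g) (f (suc n)) (g (suc n)))
  where
  interchange : ∀ a b c d → a + b + (c + d) ≡ a + c + (b + d)
  interchange = solve-∀

sumTo-*ˡ : ∀ n c (f : ℕ → ℤ) → sumTo n (λ k → c * f k) ≡ c * sumTo n f
sumTo-*ˡ zero    c f = refl
sumTo-*ˡ (suc n) c f =
  trans (cong (_+ c * f (suc n)) (sumTo-*ˡ n c f)) (sym (ℤₚ.*-distribˡ-+ c _ _))

sumTo-peel : ∀ n (f : ℕ → ℤ) → sumTo (suc n) f ≡ f 0 + sumTo n (f ∘ suc)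
sumTo-peel zero    f = refl
sumTo-peel (suc n) f =
  trans (cong (_+ f (suc (suc n))) (sumTo-peel n f))
        (ℤₚ.+-assoc (f 0) (sumTo n (f ∘ suc)) (f (suc (suc n))))

pascal-sum : ∀ n (f : ℕ → ℤ) →
  sumTo (suc n) (λ k → + (suc n C k) * f k)
    ≡ sumTo n (λ k → + (n C k) * f (suc k)) + sumTo n (λ k → + (n C k) * f k)
pascal-sum n f = begin
    sumTo (suc n) (λ k → + (suc n C k) * f k)
  ≡⟨ sumTo-peel n _ ⟩
    f₀ + sumTo n (λ k → + (suc n C suc k) * f (suc k))
  ≡⟨ cong (λ z → f₀ + z) (sumTo-cong n (λ k _ → pascal k)) ⟩
    f₀ + sumTo n (λ k → Left k + Right (suc k))
  ≡⟨ cong (λ z → f₀ + z) (sumTo-+ n Left (Right ∘ suc)) ⟩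
    f₀ + (sumTo n Left + sumTo n (Right ∘ suc))
  ≡⟨ regroup f₀ (sumTo n Left) (sumTo n (Right ∘ suc)) ⟩
    sumTo n Left + (f₀ + sumTo n (Right ∘ suc))
  ≡⟨ cong (λ z → sumTo n Left + z) (sym (sumTo-peel n Right)) ⟩
    sumTo n Left + (sumTo n Right + Right (suc n))
  ≡⟨ cong (λ z → sumTo n Left + (sumTo n Right + z * f (suc n))) (cong +_ (k>n⇒nCk≡0 (ℕₚ.n<1+n n))) ⟩
    sumTo n Left + (sumTo n Right + + 0 * f (suc n))
  ≡⟨ cong (λ z → sumTo n Left + z) (vanish (sumTo n Right) (f (suc n))) ⟩
    sumTo n Left + sumTo n Right
  ∎
  where
  open ≡-Reasoning
  Left Right : ℕ → ℤ
  Left  k = + (n C k) * f (suc k)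
  Right k = + (n C k) * f k
  f₀ : ℤ
  f₀ = Right 0
  pascal : ∀ k → + (suc n C suc k) * f (suc k) ≡ Left k + Right (suc k)
  pascal k = begin
      + (suc n C suc k) * f (suc k)
    ≡⟨ cong (λ c → + c * f (suc k)) (sym (nCk+nC[k+1]≡[n+1]C[k+1] n k)) ⟩
      + (n C k ℕ.+ n C suc k) * f (suc k)
    ≡⟨ cong (_* f (suc k)) (ℤₚ.pos-+ (n C k) (n C suc k)) ⟩
      (+ (n C k) + + (n C suc k)) * f (suc k)
    ≡⟨ ℤₚ.*-distribʳ-+ (f (suc k)) (+ (n C k)) (+ (n C suc k)) ⟩
      Left k + Right (suc k)
    ∎
  regroup : ∀ a b c → a + (b + c) ≡ b + (a + c)
  regroup = solve-∀
  vanish : ∀ a b → a + + 0 * b ≡ a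
  vanish = solve-∀

Recurrent : (ℤ → ℤ) → Set
Recurrent F = ∀ t → F (t + + 3) ≡ F (t + + 1) + F t

_⊕_ : Window → Window → Window
(a , b , c) ⊕ (a′ , b′ , c′) = (a + a′ , b + b′ , c + c′)

stepF-⊕ : ∀ w w′ → stepF (w ⊕ w′) ≡ stepF w ⊕ stepF w′
stepF-⊕ (a , b , c) (a′ , b′ , c′) = cong (λ z → b + b′ , c + c′ , z) (interchange b b′ a a′)
  where
  interchange : ∀ b b′ a a′ → b + b′ + (a + a′) ≡ b + a + (b′ + a′)
  interchange = solve-∀

stepB-⊕ : ∀ w w′ → stepB (w ⊕ w′) ≡ stepB w ⊕ stepB w′
stepB-⊕ (a , b , c) (a′ , b′ , c′) = cong (λ z → z , a + a′ , b + b′) (interchange c c′ a a′)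
  where
  interchange : ∀ c c′ a a′ → c + c′ - (a + a′) ≡ c - a + (c′ - a′)
  interchange = solve-∀

iterF-⊕ : ∀ k w w′ → iterF k (w ⊕ w′) ≡ iterF k w ⊕ iterF k w′
iterF-⊕ zero    w w′ = refl
iterF-⊕ (suc k) w w′ = trans (cong (iterF k) (stepF-⊕ w w′)) (iterF-⊕ k (stepF w) (stepF w′))

iterB-⊕ : ∀ k w w′ → iterB k (w ⊕ w′) ≡ iterB k w ⊕ iterB k w′
iterB-⊕ zero    w w′ = refl
iterB-⊕ (suc k) w w′ = trans (cong (iterB k) (stepB-⊕ w w′)) (iterB-⊕ k (stepB w) (stepB w′))

seqAt-⊕ : ∀ w w′ t → seqAt (w ⊕ w′) t ≡ seqAt w t + seqAt w′ t
seqAt-⊕ w w′ (+ n)    = cong proj₁ (iterF-⊕ n w w′)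
seqAt-⊕ w w′ -[1+ n ] = cong proj₁ (iterB-⊕ (suc n) w w′)

stepB∘stepF : ∀ w → stepB (stepF w) ≡ w
stepB∘stepF (a , b , c) = cong (λ z → z , b , c) (cancel a b)
  where
  cancel : ∀ a b → b + a - b ≡ a
  cancel = solve-∀

seqAt-stepF : ∀ w t → seqAt w (t + + 1) ≡ seqAt (stepF w) t
seqAt-stepF w (+ n)            = cong (λ k → proj₁ (iterF k w)) (ℕₚ.+-comm n 1)
seqAt-stepF w -[1+ zero ]      = sym (cong proj₁ (stepB∘stepF w))
seqAt-stepF w -[1+ suc n ]     = sym (cong (proj₁ ∘ iterB (suc n)) (stepB∘stepF w))

-- Every sequence seqAt w satisfies the recurrence, since three forward steps
-- of a window equal one step plus the window itself.
seqAt-recurrent : ∀ w → Recurrent (seqAt w)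
seqAt-recurrent w t = begin
    seqAt w (t + + 3)
  ≡⟨ cong (seqAt w) (three-steps t) ⟩
    seqAt w (t + + 1 + + 1 + + 1)
  ≡⟨ seqAt-stepF w (t + + 1 + + 1) ⟩
    seqAt (stepF w) (t + + 1 + + 1)
  ≡⟨ seqAt-stepF (stepF w) (t + + 1) ⟩
    seqAt (stepF (stepF w)) (t + + 1)
  ≡⟨ seqAt-stepF (stepF (stepF w)) t ⟩
    seqAt (stepF w ⊕ w) t
  ≡⟨ seqAt-⊕ (stepF w) w t ⟩
    seqAt (stepF w) t + seqAt w t
  ≡⟨ cong (_+ seqAt w t) (sym (seqAt-stepF w t)) ⟩
    seqAt w (t + + 1) + seqAt w t
  ∎
  where
  open ≡-Reasoning
  three-steps : ∀ t → t + + 3 ≡ t + + 1 + + 1 + + 1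
  three-steps = solve-∀

P-recurrent : Recurrent P
P-recurrent = seqAt-recurrent (+ 1 , + 1 , + 1)

Q-recurrent : Recurrent Q
Q-recurrent = seqAt-recurrent (+ 3 , + 0 , + 2)

recurrent-shift : ∀ {F} → Recurrent F → ∀ u → Recurrent (λ t → F (t + u))
recurrent-shift {F} rec u t =
  trans (cong F (reorder t u (+ 3))) (trans (rec (t + u)) (cong (λ z → F z + F (t + u)) (sym (reorder t u (+ 1)))))
  where
  reorder : ∀ t u a → t + a + u ≡ t + u + a
  reorder = solve-∀

recurrent-combination : ∀ {G₁ G₂ G₃} → Recurrent G₁ → Recurrent G₂ → Recurrent G₃ →
  ∀ a b c → Recurrent (λ t → G₁ t * a + G₂ t * b + G₃ t * c)
recurrent-combination {G₁} {G₂} {G₃} rec₁ rec₂ rec₃ a b c t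
  rewrite rec₁ t | rec₂ t | rec₃ t =
    distribute (G₁ (t + + 1)) (G₁ t) (G₂ (t + + 1)) (G₂ t) (G₃ (t + + 1)) (G₃ t) a b c
  where
  distribute : ∀ x₁ x₀ y₁ y₀ z₁ z₀ a b c →
    (x₁ + x₀) * a + (y₁ + y₀) * b + (z₁ + z₀) * c ≡
    (x₁ * a + y₁ * b + z₁ * c) + (x₀ * a + y₀ * b + z₀ * c)
  distribute = solve-∀

AgreeAt : (G H : ℤ → ℤ) → ℤ → Set
AgreeAt G H t = G t ≡ H t × G (t + + 1) ≡ H (t + + 1) × G (t + + 2) ≡ H (t + + 2)

module _ {G H : ℤ → ℤ} (recG : Recurrent G) (recH : Recurrent H) where

  private
    agree-at : ∀ {s s′} → s ≡ s′ → G s ≡ H s → G s′ ≡ H s′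
    agree-at eq = subst (λ r → G r ≡ H r) eq

    plus-1-1 : ∀ t → t + + 1 + + 1 ≡ t + + 2
    plus-1-1 = solve-∀

    plus-1-2 : ∀ t → t + + 1 + + 2 ≡ t + + 3
    plus-1-2 = solve-∀

    solve-for-last : ∀ a b → b ≡ a + b - a
    solve-for-last = solve-∀

  agree-forward : ∀ t → AgreeAt G H t → AgreeAt G H (t + + 1)
  agree-forward t (e₀ , e₁ , e₂) =
    e₁ , agree-at (sym (plus-1-1 t)) e₂ ,
    agree-at (sym (plus-1-2 t)) (trans (recG t) (trans (cong₂ _+_ e₁ e₀) (sym (recH t))))

  agree-backward : ∀ t → AgreeAt G H (t + + 1) → AgreeAt G H t
  agree-backward t (e₁ , e₂ , e₃) = e₀ , e₁ , agree-at (plus-1-1 t) e₂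
    where
    e₀ : G t ≡ H t
    e₀ = begin
        G t                           ≡⟨ solve-for-last (G (t + + 1)) (G t) ⟩
        G (t + + 1) + G t - G (t + + 1) ≡⟨ cong (_- G (t + + 1)) (sym (recG t)) ⟩
        G (t + + 3) - G (t + + 1)     ≡⟨ cong₂ _-_ (agree-at (plus-1-2 t) e₃) e₁ ⟩
        H (t + + 3) - H (t + + 1)     ≡⟨ cong (_- H (t + + 1)) (recH t) ⟩
        H (t + + 1) + H t - H (t + + 1) ≡⟨ sym (solve-for-last (H (t + + 1)) (H t)) ⟩
        H t                           ∎
      where open ≡-Reasoning

  recurrent-unique : AgreeAt G H (+ 0) → G ≗ H
  recurrent-unique agree₀ t = proj₁ (agree t)
    where
    agree-pos : ∀ n → AgreeAt G H (+ n)
    agree-pos zero    = agree₀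
    agree-pos (suc n) = subst (AgreeAt G H) (cong +_ (ℕₚ.+-comm n 1)) (agree-forward (+ n) (agree-pos n))
    agree-neg : ∀ n → AgreeAt G H -[1+ n ]
    agree-neg zero    = agree-backward -[1+ 0 ] agree₀
    agree-neg (suc n) = agree-backward -[1+ suc n ] (agree-neg n)
    agree : ∀ t → AgreeAt G H t
    agree (+ n)    = agree-pos n
    agree -[1+ n ] = agree-neg n

-- Both sides are recurrent in p (the right side as a combination of shifted
-- copies of P) and agree for p = 0, 1, 2, where (P_{p-5}, P_{p-3}, P_{p-4})
-- runs through the unit vectors.
addition-formula : ∀ {F} → Recurrent F → ∀ u p →
  F (u + p) ≡ P (p - + 5) * F u + P (p - + 3) * F (u + + 1) + P (p - + 4) * F (u + + 2)
addition-formula {F} recF u p =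
  trans (cong F (ℤₚ.+-comm u p)) (recurrent-unique recShifted recCombination initial p)
  where
  recShifted : Recurrent (λ t → F (t + u))
  recShifted = recurrent-shift {F} recF u
  recCombination : Recurrent (λ t → P (t - + 5) * F u + P (t - + 3) * F (u + + 1) + P (t - + 4) * F (u + + 2))
  recCombination =
    recurrent-combination {λ t → P (t - + 5)} {λ t → P (t - + 3)} {λ t → P (t - + 4)}
                          (recurrent-shift {P} P-recurrent (- + 5)) (recurrent-shift {P} P-recurrent (- + 3))
                          (recurrent-shift {P} P-recurrent (- + 4)) (F u) (F (u + + 1)) (F (u + + 2))
  initial : AgreeAt (λ t → F (t + u))
                    (λ t → P (t - + 5) * F u + P (t - + 3) * F (u + + 1) + P (t - + 4) * F (u + + 2)) (+ 0)
  initial =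
    trans (cong F (ℤₚ.+-identityˡ u)) (unit₁ (F u) (F (u + + 1)) (F (u + + 2))) ,
    trans (cong F (ℤₚ.+-comm (+ 1) u)) (unit₂ (F u) (F (u + + 1)) (F (u + + 2))) ,
    trans (cong F (ℤₚ.+-comm (+ 2) u)) (unit₃ (F u) (F (u + + 1)) (F (u + + 2)))
    where
    unit₁ : ∀ a b c → a ≡ + 1 * a + + 0 * b + + 0 * c
    unit₁ = solve-∀
    unit₂ : ∀ a b c → b ≡ + 0 * a + + 1 * b + + 0 * c
    unit₂ = solve-∀
    unit₃ : ∀ a b c → c ≡ + 0 * a + + 0 * b + + 1 * c
    unit₃ = solve-∀

Op : Set
Op = (ℤ → ℤ) → (ℤ → ℤ)

record Linear (M : Op) : Set where
  field
    op-cong : ∀ {G H} → G ≗ H → M G ≗ M H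
    op-lin  : ∀ a b G H → M (λ u → a * G u + b * H u) ≗ (λ u → a * M G u + b * M H u)

open Linear

_·_+id·_ : ℤ → Op → ℤ → Op
(x · M +id· y) G u = x * M G u + y * G u

iterate-cong : ∀ {M} → Linear M → ∀ k {G H} → G ≗ H → iterate M G k ≗ iterate M H k
iterate-cong linM zero    eq = eq
iterate-cong linM (suc k) eq = iterate-cong linM k (op-cong linM eq)

iterate-lin : ∀ {M} → Linear M → ∀ k a b G H →
  iterate M (λ u → a * G u + b * H u) k ≗ (λ u → a * iterate M G k u + b * iterate M H k u)
iterate-lin linM zero    a b G H t = refl
iterate-lin {M} linM (suc k) a b G H t =
  trans (iterate-cong linM k (op-lin linM a b G H) t) (iterate-lin linM k a b (M G) (M H) t)

·+id·-linear : ∀ {M} → Linear M → ∀ x y → Linear (x · M +id· y)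
·+id·-linear {M} linM x y = record
  { op-cong = λ eq u → cong₂ (λ a b → x * a + y * b) (op-cong linM eq u) (eq u)
  ; op-lin  = λ a b G H u →
      trans (cong (λ z → x * z + y * (a * G u + b * H u)) (op-lin linM a b G H u))
            (regroup x y a b (M G u) (M H u) (G u) (H u))
  }
  where
  regroup : ∀ x y a b mg mh g h →
    x * (a * mg + b * mh) + y * (a * g + b * h) ≡ a * (x * mg + y * g) + b * (x * mh + y * h)
  regroup = solve-∀

∘-linear : ∀ {M N} → Linear M → Linear N → Linear (M ∘ N)
∘-linear {M} {N} linM linN = record
  { op-cong = λ eq → op-cong linM (op-cong linN eq)
  ; op-lin  = λ a b G H u → trans (op-cong linM (op-lin linN a b G H) u) (op-lin linM a b (N G) (N H) u)
  }

module _ {M N : Op} (linM : Linear M) (linN : Linear N) (commute : ∀ G → M (N G) ≗ N (M G)) where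

  iterate-commute : ∀ j G → iterate N (M G) j ≗ M (iterate N G j)
  iterate-commute zero    G t = refl
  iterate-commute (suc j) G t =
    trans (iterate-cong linN j (λ u → sym (commute G u)) t) (iterate-commute j (N G) t)

  iterate-∘ : ∀ j F → iterate M (iterate N F j) j ≗ iterate (M ∘ N) F j
  iterate-∘ zero    F t = refl
  iterate-∘ (suc j) F t =
    trans (iterate-cong linM j (λ u → sym (iterate-commute j (N F) u)) t) (iterate-∘ j (M (N F)) t)

-- Induction on n: Pascal's rule splits the sum for n+1 into the two halves
-- of the sum for n applied to x M G + y G.
binomial : ∀ {M} → Linear M → ∀ x y n G t →
  sumTo n (λ k → + (n C k) * (x ^ k * y ^ (n ∸ k) * iterate M G k t)) ≡ iterate (x · M +id· y) G n t
binomial linM x y zero    G t = one-term (G t)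
  where
  one-term : ∀ g → + 1 * (+ 1 * + 1 * g) ≡ g
  one-term = solve-∀
binomial {M} linM x y (suc n) G t = begin
    sumTo (suc n) (λ k → + (suc n C k) * (x ^ k * y ^ (suc n ∸ k) * iterate M G k t))
  ≡⟨ pascal-sum n (λ k → x ^ k * y ^ (suc n ∸ k) * iterate M G k t) ⟩
    sumTo n (λ k → + (n C k) * (x ^ suc k * y ^ (n ∸ k) * iterate M (M G) k t))
      + sumTo n (λ k → + (n C k) * (x ^ k * y ^ (suc n ∸ k) * iterate M G k t))
  ≡⟨ sym (sumTo-+ n _ _) ⟩
    sumTo n (λ k → + (n C k) * (x ^ suc k * y ^ (n ∸ k) * iterate M (M G) k t)
                   + + (n C k) * (x ^ k * y ^ (suc n ∸ k) * iterate M G k t))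
  ≡⟨ sumTo-cong n merge ⟩
    sumTo n (λ k → + (n C k) * (x ^ k * y ^ (n ∸ k) * iterate M ((x · M +id· y) G) k t))
  ≡⟨ binomial linM x y n ((x · M +id· y) G) t ⟩
    iterate (x · M +id· y) G (suc n) t
  ∎
  where
  open ≡-Reasoning
  factor : ∀ x y c xk yk I₁ I₀ →
    c * (x * xk * yk * I₁) + c * (xk * (y * yk) * I₀) ≡ c * (xk * yk * (x * I₁ + y * I₀))
  factor = solve-∀
  merge : ∀ k → k ≤ n →
    + (n C k) * (x ^ suc k * y ^ (n ∸ k) * iterate M (M G) k t)
      + + (n C k) * (x ^ k * y ^ (suc n ∸ k) * iterate M G k t)
    ≡ + (n C k) * (x ^ k * y ^ (n ∸ k) * iterate M ((x · M +id· y) G) k t)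
  merge k k≤n = begin
      + (n C k) * (x ^ suc k * y ^ (n ∸ k) * iterate M (M G) k t)
        + + (n C k) * (x ^ k * y ^ (suc n ∸ k) * iterate M G k t)
    ≡⟨ cong (λ e → + (n C k) * (x ^ suc k * y ^ (n ∸ k) * iterate M (M G) k t)
                   + + (n C k) * (x ^ k * y ^ e * iterate M G k t)) (ℕₚ.+-∸-assoc 1 k≤n) ⟩
      + (n C k) * (x ^ suc k * y ^ (n ∸ k) * iterate M (M G) k t)
        + + (n C k) * (x ^ k * y ^ suc (n ∸ k) * iterate M G k t)
    ≡⟨ factor x y (+ (n C k)) (x ^ k) (y ^ (n ∸ k)) (iterate M (M G) k t) (iterate M G k t) ⟩
      + (n C k) * (x ^ k * y ^ (n ∸ k) * (x * iterate M (M G) k t + y * iterate M G k t))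
    ≡⟨ cong (λ z → + (n C k) * (x ^ k * y ^ (n ∸ k) * z)) (sym (iterate-lin linM k x y (M G) G t)) ⟩
      + (n C k) * (x ^ k * y ^ (n ∸ k) * iterate M ((x · M +id· y) G) k t)
    ∎

shift : Op
shift G u = G (u + + 1)

shift-linear : Linear shift
shift-linear = record { op-cong = λ eq u → eq (u + + 1) ; op-lin = λ a b G H u → refl }

iterate-shift : ∀ k G t → iterate shift G k t ≡ G (t + + k)
iterate-shift zero    G t = sym (cong G (ℤₚ.+-identityʳ t))
iterate-shift (suc k) G t =
  trans (iterate-shift k (shift G) t)
        (cong G (trans (ℤₚ.+-assoc t (+ k) (+ 1)) (cong (λ i → t + + i) (ℕₚ.+-comm k 1))))

module ShiftBy (p : ℤ) where

  α β γ : ℤ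
  α = P (p - + 5)
  β = P (p - + 3)
  γ = P (p - + 4)

  A L : Op
  A = γ · shift +id· β
  L = (+ 1) · (A ∘ shift) +id· α

  A-linear : Linear A
  A-linear = ·+id·-linear shift-linear γ β

  A∘shift-linear : Linear (A ∘ shift)
  A∘shift-linear = ∘-linear A-linear shift-linear

  L-linear : Linear L
  L-linear = ·+id·-linear A∘shift-linear (+ 1) α

  L-shifts : ∀ {F} → Recurrent F → L F ≗ (λ u → F (u + p))
  L-shifts {F} recF u = begin
      + 1 * (γ * F (u + + 1 + + 1) + β * F (u + + 1)) + α * F u
    ≡⟨ cong (λ z → + 1 * (γ * F z + β * F (u + + 1)) + α * F u) (plus-1-1 u) ⟩
      + 1 * (γ * F (u + + 2) + β * F (u + + 1)) + α * F u
    ≡⟨ reorder α β γ (F u) (F (u + + 1)) (F (u + + 2)) ⟩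
      α * F u + β * F (u + + 1) + γ * F (u + + 2)
    ≡⟨ sym (addition-formula recF u p) ⟩
      F (u + p)
    ∎
    where
    open ≡-Reasoning
    plus-1-1 : ∀ u → u + + 1 + + 1 ≡ u + + 2
    plus-1-1 = solve-∀
    reorder : ∀ α β γ f₀ f₁ f₂ → + 1 * (γ * f₂ + β * f₁) + α * f₀ ≡ α * f₀ + β * f₁ + γ * f₂
    reorder = solve-∀

  iterate-L : ∀ n {F} → Recurrent F → iterate L F n ≗ (λ u → F (u + p * + n))
  iterate-L zero    {F} recF u = cong F (sym (no-shift u p))
    where
    no-shift : ∀ u p → u + p * + 0 ≡ u
    no-shift = solve-∀
  iterate-L (suc n) {F} recF u =
    trans (iterate-cong L-linear n (L-shifts recF) u)
          (trans (iterate-L n (recurrent-shift {F} recF p) u) (cong F (collect u p (+ n))))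
    where
    collect : ∀ u p n → u + p * n + p ≡ u + p * (+ 1 + n)
    collect = solve-∀

  -- The inner sum over k is the binomial expansion of A^j = (γE + β)^j
  -- applied to E^j F; since A and E commute this is (A E)^j F.
  inner-sum : ∀ F n s j →
    sumTo j (λ k → + (n C j) * + (j C k) * γ ^ k * β ^ (j ∸ k) * α ^ (n ∸ j) * F (s + + k + + j))
      ≡ + (n C j) * ((+ 1) ^ j * α ^ (n ∸ j) * iterate (A ∘ shift) F j s)
  inner-sum F n s j = begin
      sumTo j (λ k → + (n C j) * + (j C k) * γ ^ k * β ^ (j ∸ k) * α ^ (n ∸ j) * F (s + + k + + j))
    ≡⟨ sumTo-cong j (λ k _ → pull-out k) ⟩
      sumTo j (λ k → c * (+ (j C k) * (γ ^ k * β ^ (j ∸ k) * iterate shift (iterate shift F j) k s)))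
    ≡⟨ sumTo-*ˡ j c _ ⟩
      c * sumTo j (λ k → + (j C k) * (γ ^ k * β ^ (j ∸ k) * iterate shift (iterate shift F j) k s))
    ≡⟨ cong (c *_) (binomial shift-linear γ β j (iterate shift F j) s) ⟩
      c * iterate A (iterate shift F j) j s
    ≡⟨ cong (c *_) (iterate-∘ A-linear shift-linear (λ G u → refl) j F s) ⟩
      c * iterate (A ∘ shift) F j s
    ≡⟨ insert-one (+ (n C j)) (α ^ (n ∸ j)) (iterate (A ∘ shift) F j s) (ℤₚ.^-zeroˡ j) ⟩
      + (n C j) * ((+ 1) ^ j * α ^ (n ∸ j) * iterate (A ∘ shift) F j s)
    ∎
    where
    open ≡-Reasoning
    c : ℤ
    c = + (n C j) * α ^ (n ∸ j)
    regroup : ∀ a b g b′ a′ f → a * b * g * b′ * a′ * f ≡ (a * a′) * (b * (g * b′ * f))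
    regroup = solve-∀
    pull-out : ∀ k →
      + (n C j) * + (j C k) * γ ^ k * β ^ (j ∸ k) * α ^ (n ∸ j) * F (s + + k + + j)
        ≡ c * (+ (j C k) * (γ ^ k * β ^ (j ∸ k) * iterate shift (iterate shift F j) k s))
    pull-out k =
      trans (regroup (+ (n C j)) (+ (j C k)) (γ ^ k) (β ^ (j ∸ k)) (α ^ (n ∸ j)) (F (s + + k + + j)))
            (cong (λ z → c * (+ (j C k) * (γ ^ k * β ^ (j ∸ k) * z)))
                  (sym (trans (iterate-shift k (iterate shift F j) s) (iterate-shift j F (s + + k)))))
    insert-one : ∀ a x I {o} → o ≡ + 1 → a * x * I ≡ a * (o * x * I)
    insert-one a x I refl = unit a x I
      where
      unit : ∀ a x I → a * x * I ≡ a * (+ 1 * x * I)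
      unit = solve-∀

  -- The double sum is the binomial expansion of L^n = ((γE + β)E + α)^n.
  doubleSum-shift : ∀ {F} → Recurrent F → ∀ n s → doubleSum n γ β α F s ≡ F (s + p * + n)
  doubleSum-shift {F} recF n s =
    trans (sumTo-cong n (λ j _ → inner-sum F n s j))
          (trans (binomial A∘shift-linear (+ 1) α n F s) (iterate-L n recF s))

theorem17 : (n : ℕ) → NonZero n → (m p q : ℤ) →
    (doubleSum n (P (p - + 4)) (P (p - + 3)) (P (p - + 5)) P (m * + n + q) ≡ P ((m + p) * + n + q))
    × (doubleSum n (P (m - + 4)) (P (m - + 3)) (P (m - + 5)) P (p * + n + q) ≡ P ((m + p) * + n + q))
    × (doubleSum n (P (p - + 4)) (P (p - + 3)) (P (p - + 5)) Q (m * + n + q) ≡ Q ((m + p) * + n + q))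
    × (doubleSum n (P (m - + 4)) (P (m - + 3)) (P (m - + 5)) Q (p * + n + q) ≡ Q ((m + p) * + n + q))
theorem17 n _ m p q =
  trans (ShiftBy.doubleSum-shift p {P} P-recurrent n (m * + n + q)) (cong P (shift-by-p m p q (+ n))) ,
  trans (ShiftBy.doubleSum-shift m {P} P-recurrent n (p * + n + q)) (cong P (shift-by-m m p q (+ n))) ,
  trans (ShiftBy.doubleSum-shift p {Q} Q-recurrent n (m * + n + q)) (cong Q (shift-by-p m p q (+ n))) ,
  trans (ShiftBy.doubleSum-shift m {Q} Q-recurrent n (p * + n + q)) (cong Q (shift-by-m m p q (+ n)))
  where
  shift-by-p : ∀ m p q n → m * n + q + p * n ≡ (m + p) * n + q
  shift-by-p = solve-∀
  shift-by-m : ∀ m p q n → p * n + q + m * n ≡ (m + p) * n + q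
  shift-by-m = solve-∀
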